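{- Let $n\ge1$ and $\mathbb{D}_n=\mathbb{D}_{\mathbf{Tam}_n}(x,y,\overline{y},\overline{x})$. Every monomial of $\mathbb{D}_n$ has total degree at most $n-1$ with respect to each of the pairs of variables $(x,\overline{y})$, $(y,\overline{x})$, $(x,y)$, $(\overline{x},\overline{y})$ and $(y,\overline{y})$, and has degree at most $n-1$ in each single variable $x$, $y$, $\overline{y}$, $\overline{x}$.
   Context: For a finite poset $P$ with covering relation $\triangleleft$, $\mathbb{D}_P(x,y,\overline{y},\overline{x})=\sum_{(u,v)}x^ay^b\overline{y}^c\overline{x}^d$, summed over intervals $u\le v$, where $a$ is the number of $u'$ with $u\triangleleft u'\le v$, $b$ the number of $v'$ with $v\triangleleft v'$, $c$ the number of $u'$ with $u'\triangleleft u$, $d$ the number of $v'$ with $u\le v'\triangleleft v$. For $n\ge1$, $\mathbf{Tam}_n$ is the poset on planar binary trees with $n$ internal vertices whose covering relations are the rotations replacing a subtree $(A,(B,C))$ (internal vertex with left subtree $A$ and right subtree an internal vertex with subtrees $B,C$) by $((A,B),C)$; the order is the reflexive-transitive closure. -}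

module Defs where

open import Data.Nat using (ℕ; zero; suc; _+_; _∸_; _≤_)
open import Data.Product using (_×_)
open import Data.List using (List; length)
open import Data.List.Membership.Propositional using (_∈_)
open import Data.List.Relation.Unary.Unique.Propositional using (Unique)
open import Function.Bundles using (_⇔_)
open import Relation.Binary.Construct.Closure.ReflexiveTransitive using (Star)

data Tree : Set where
  leaf : Tree
  node : Tree → Tree → Tree

size : Tree → ℕ
size leaf = 0
size (node l r) = suc (size l + size r)

-- One rotation (A,(B,C)) ↦ ((A,B),C), applied at any subtree.
-- This is the covering relation of the Tamari lattice.
data _⋖_ : Tree → Tree → Set where
  rot   : ∀ A B C → node A (node B C) ⋖ node (node A B) C
  left  : ∀ {l l'} r → l ⋖ l' → node l r ⋖ node l' r
  right : ∀ l {r r'} → r ⋖ r' → node l r ⋖ node l r'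

_≤T_ : Tree → Tree → Set
_≤T_ = Star _⋖_

-- L is a duplicate-free list of exactly the trees satisfying P
-- (so length L is the number of such trees).
Enumerates : (Tree → Set) → List Tree → Set
Enumerates P L = Unique L × (∀ t → (t ∈ L) ⇔ P t)

-- Degree bounds for a monomial x^a y^b ybar^c xbar^d with bound m = n - 1.
DegreeBounds : ℕ → ℕ → ℕ → ℕ → ℕ → Set
DegreeBounds m a b c d =
  (a + c ≤ m) × (b + d ≤ m) × (a + b ≤ m) × (d + c ≤ m) × (b + c ≤ m)
  × (a ≤ m) × (b ≤ m) × (c ≤ m) × (d ≤ m)

-- Read a tree with n internal vertices through its edge word, a word of length
-- n - 1 whose letter k says whether the edge joining the in-order vertices k and
-- k + 1 goes to a left child (false) or to a right child (true).  A rotation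
-- turns the true letter of the rotated edge at position i into a false letter at
-- a position j of the new word, and the edge word decreases letterwise along
-- the Tamari order.  The rotation is determined by its tree together with either
-- i or j, so upper covers of t inject (via i) into the true letters of every
-- s ≤ t and (via j) into the false letters of every s above them; dually for
-- lower covers.  Each of the degree bounds then compares two sets of covers
-- with the true and the false letters of a single tree, which are n - 1 in all.
module Submission where

open import Defs
open import Data.Bool using (Bool; true; false; f≤t; b≤b) renaming (_≤_ to _≤ᵇ_)
import Data.Bool.Properties as Bool
open import Data.Empty using (⊥-elim)
open import Data.List using (List; []; _∷_; _++_; length; map)
open import Data.List.Membership.Propositional using (_∈_; _─_)
open import Data.List.Membership.Propositional.Properties using (∈-map⁺)
open import Data.List.Properties using (++-assoc; length-++; length-map; length-removeAt′)
open import Data.List.Relation.Binary.Pointwise as Pointwise using (Pointwise; []; _∷_)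
open import Data.List.Relation.Unary.All as All using ()
open import Data.List.Relation.Unary.AllPairs using (_∷_)
open import Data.List.Relation.Unary.Any using (here; there)
open import Data.List.Relation.Unary.Unique.Propositional using (Unique)
open import Data.Maybe using (Maybe; just; nothing)
open import Data.Nat using (ℕ; zero; suc; _+_; _∸_; _≤_; _<_; z≤n; s≤s; s<s⁻¹)
open import Data.Nat.Properties
open import Data.Product using (_×_; ∃-syntax; _,_; proj₁; proj₂; swap)
open import Function.Bundles using (Equivalence)
open import Relation.Binary.Construct.Closure.ReflexiveTransitive using (ε; _◅_)
open import Relation.Binary.PropositionalEquality
  using (_≡_; _≢_; refl; sym; trans; cong; cong₂; subst; module ≡-Reasoning)

∈-─ : ∀ {B : Set} {b b′} {M : List B} (p : b ∈ M) → b′ ∈ M → b′ ≢ b → b′ ∈ M ─ p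
∈-─ (here refl) (here b′≡b) b′≢b = ⊥-elim (b′≢b b′≡b)
∈-─ (here refl) (there q)   _    = q
∈-─ (there p)   (here refl) _    = here refl
∈-─ (there p)   (there q)   b′≢b = there (∈-─ p q b′≢b)

pigeonhole : ∀ {A B : Set} (R : A → B → Set) → (∀ {a a′ b} → R a b → R a′ b → a ≡ a′) →
             ∀ {L M} → Unique L → (∀ {a} → a ∈ L → ∃[ b ] b ∈ M × R a b) →
             length L ≤ length M
pigeonhole R R-injective {[]}    _            _ = z≤n
pigeonhole R R-injective {a ∷ L} {M} (a∉L ∷ !L) f with f (here refl)
... | b , b∈M , Rab =
  subst (suc (length L) ≤_) (sym (length-removeAt′ M _))
    (s≤s (pigeonhole R R-injective !L f′))
  where
  f′ : ∀ {a′} → a′ ∈ L → ∃[ b′ ] b′ ∈ M ─ b∈M × R a′ b′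
  f′ a′∈L with f (there a′∈L)
  ... | b′ , b′∈M , Ra′b′ = b′ , ∈-─ b∈M b′∈M b′≢b , Ra′b′
    where
    b′≢b : _ ≢ b
    b′≢b refl = All.lookup a∉L a′∈L (R-injective Rab Ra′b′)

module _ {A : Set} where

  infixl 5 _‼_
  _‼_ : List A → ℕ → Maybe A
  []       ‼ _     = nothing
  (x ∷ xs) ‼ zero  = just x
  (x ∷ xs) ‼ suc i = xs ‼ i

  ‼-++ˡ : ∀ xs {ys i x} → xs ‼ i ≡ just x → (xs ++ ys) ‼ i ≡ just x
  ‼-++ˡ (x ∷ xs) {i = zero}  e = e
  ‼-++ˡ (x ∷ xs) {i = suc i} e = ‼-++ˡ xs e

  ‼-++ʳ : ∀ xs {ys} i → (xs ++ ys) ‼ (length xs + i) ≡ ys ‼ i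
  ‼-++ʳ []       i = refl
  ‼-++ʳ (x ∷ xs) i = ‼-++ʳ xs i

  ‼-length : ∀ xs {y ys} → (xs ++ y ∷ ys) ‼ length xs ≡ just y
  ‼-length []       = refl
  ‼-length (x ∷ xs) = ‼-length xs

  ‼⇒<length : ∀ xs {i x} → xs ‼ i ≡ just x → i < length xs
  ‼⇒<length (x ∷ xs) {zero}  _ = s≤s z≤n
  ‼⇒<length (x ∷ xs) {suc i} e = s≤s (‼⇒<length xs e)

indices : Bool → List Bool → List ℕ
indices b [] = []
indices true  (true  ∷ bs) = 0 ∷ map suc (indices true bs)
indices false (false ∷ bs) = 0 ∷ map suc (indices false bs)
indices true  (false ∷ bs) = map suc (indices true bs)
indices false (true  ∷ bs) = map suc (indices false bs)

‼⇒∈indices : ∀ bs {i b} → bs ‼ i ≡ just b → i ∈ indices b bs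
‼⇒∈indices (true  ∷ bs) {zero}          refl = here refl
‼⇒∈indices (false ∷ bs) {zero}          refl = here refl
‼⇒∈indices (true  ∷ bs) {suc i} {true}  e    = there (∈-map⁺ suc (‼⇒∈indices bs e))
‼⇒∈indices (true  ∷ bs) {suc i} {false} e    = ∈-map⁺ suc (‼⇒∈indices bs e)
‼⇒∈indices (false ∷ bs) {suc i} {true}  e    = ∈-map⁺ suc (‼⇒∈indices bs e)
‼⇒∈indices (false ∷ bs) {suc i} {false} e    = there (∈-map⁺ suc (‼⇒∈indices bs e))

length-indices : ∀ bs → length (indices true bs) + length (indices false bs) ≡ length bs
length-indices []           = refl
length-indices (true  ∷ bs)
  rewrite length-map suc (indices true bs) | length-map suc (indices false bs)
  = cong suc (length-indices bs)
length-indices (false ∷ bs)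
  rewrite length-map suc (indices true bs) | length-map suc (indices false bs)
  = trans (+-suc _ _) (cong suc (length-indices bs))

infix 4 _≼_
_≼_ : List Bool → List Bool → Set
_≼_ = Pointwise _≤ᵇ_

≼-refl : ∀ {xs} → xs ≼ xs
≼-refl = Pointwise.refl Bool.≤-refl

≼-trans : ∀ {xs ys zs} → xs ≼ ys → ys ≼ zs → xs ≼ zs
≼-trans = Pointwise.transitive Bool.≤-trans

≼-‼-true : ∀ {xs ys i} → xs ≼ ys → xs ‼ i ≡ just true → ys ‼ i ≡ just true
≼-‼-true {i = zero}  (b≤b ∷ _)  e = e
≼-‼-true {i = suc i} (_   ∷ ≤s) e = ≼-‼-true ≤s e

≼-‼-false : ∀ {xs ys i} → xs ≼ ys → ys ‼ i ≡ just false → xs ‼ i ≡ just false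
≼-‼-false {i = zero}  (b≤b ∷ _)  e = e
≼-‼-false {i = suc i} (_   ∷ ≤s) e = ≼-‼-false ≤s e

edgeTo : Bool → Tree → List Bool
edgeTo b leaf       = []
edgeTo b (node _ _) = b ∷ []

edgeWord : Tree → List Bool
edgeWord leaf       = []
edgeWord (node l r) = (edgeWord l ++ edgeTo false l) ++ (edgeTo true r ++ edgeWord r)

length-edgeWord : ∀ t → length (edgeWord t) ≡ size t ∸ 1
length-edgeWord-edgeTo : ∀ t → length (edgeWord t ++ edgeTo false t) ≡ size t

length-edgeWord leaf       = refl
length-edgeWord (node l r) = trans (length-++ (edgeWord l ++ edgeTo false l))
  (cong₂ _+_ (length-edgeWord-edgeTo l) (length-edgeTo-edgeWord r))
  where
  length-edgeTo-edgeWord : ∀ t → length (edgeTo true t ++ edgeWord t) ≡ size t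
  length-edgeTo-edgeWord leaf       = refl
  length-edgeTo-edgeWord (node l r) = cong suc (length-edgeWord (node l r))

length-edgeWord-edgeTo leaf       = refl
length-edgeWord-edgeTo (node l r) = trans (length-++ (edgeWord (node l r)))
  (trans (cong (_+ 1) (length-edgeWord (node l r))) (+-comm _ 1))

rightEdges leftEdges : Tree → ℕ
rightEdges t = length (indices true  (edgeWord t))
leftEdges  t = length (indices false (edgeWord t))

rightEdges+leftEdges : ∀ t → rightEdges t + leftEdges t ≡ size t ∸ 1
rightEdges+leftEdges t = trans (length-indices (edgeWord t)) (length-edgeWord t)

edgeWord-‼⇒< : ∀ t {i b} → edgeWord t ‼ i ≡ just b → suc i < size t
edgeWord-‼⇒< (node l r) e =
  s≤s (subst (_ <_) (length-edgeWord (node l r)) (‼⇒<length (edgeWord (node l r)) e))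

‼-edgeWord-left : ∀ l r {i b} → edgeWord l ‼ i ≡ just b → edgeWord (node l r) ‼ i ≡ just b
‼-edgeWord-left l r e = ‼-++ˡ (edgeWord l ++ edgeTo false l) (‼-++ˡ (edgeWord l) e)

‼-edgeWord-right : ∀ l B C i →
  edgeWord (node l (node B C)) ‼ suc (size l + i) ≡ edgeWord (node B C) ‼ i
‼-edgeWord-right l B C i = begin
    W ‼ suc (size l + i)         ≡⟨ cong (λ k → W ‼ suc (k + i)) (sym (length-edgeWord-edgeTo l)) ⟩
    W ‼ suc (length P + i)       ≡⟨ cong (W ‼_) (sym (+-suc (length P) i)) ⟩
    W ‼ (length P + suc i)       ≡⟨ ‼-++ʳ P (suc i) ⟩
    edgeWord (node B C) ‼ i      ∎
  where
  open ≡-Reasoning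
  P = edgeWord l ++ edgeTo false l
  W = P ++ true ∷ edgeWord (node B C)

edgeTo-⋖ : ∀ {b t w} → t ⋖ w → edgeTo b w ≼ edgeTo b t
edgeTo-⋖ (rot _ _ _)  = b≤b ∷ []
edgeTo-⋖ (left _ _)   = b≤b ∷ []
edgeTo-⋖ (right _ _)  = b≤b ∷ []

edgeWord-⋖ : ∀ {t w} → t ⋖ w → edgeWord w ≼ edgeWord t
edgeWord-⋖ (rot A B C) =
  subst (_≼ P ++ true ∷ ((edgeWord B ++ edgeTo false B) ++ R)) (sym reassociate)
    (Pointwise.++⁺ ≼-refl (Pointwise.++⁺ (rotatedEdge B) ≼-refl))
  where
  P = edgeWord A ++ edgeTo false A
  Y = edgeTo true B ++ edgeWord B
  R = edgeTo true C ++ edgeWord C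
  reassociate : ((P ++ Y) ++ false ∷ []) ++ R ≡ P ++ ((Y ++ false ∷ []) ++ R)
  reassociate = trans (++-assoc (P ++ Y) _ R)
    (trans (++-assoc P Y _) (cong (P ++_) (sym (++-assoc Y _ R))))
  -- The word changes, in a single letter, only when B is a leaf.
  rotatedEdge : ∀ B → (edgeTo true B ++ edgeWord B) ++ false ∷ [] ≼ true ∷ (edgeWord B ++ edgeTo false B)
  rotatedEdge leaf       = f≤t ∷ []
  rotatedEdge (node _ _) = ≼-refl
edgeWord-⋖ (left _ p)  = Pointwise.++⁺ (Pointwise.++⁺ (edgeWord-⋖ p) (edgeTo-⋖ p)) ≼-refl
edgeWord-⋖ (right l p) = Pointwise.++⁺ (≼-refl {edgeWord l ++ edgeTo false l}) (Pointwise.++⁺ (edgeTo-⋖ p) (edgeWord-⋖ p))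

edgeWord-antitone : ∀ {t w} → t ≤T w → edgeWord w ≼ edgeWord t
edgeWord-antitone ε        = ≼-refl
edgeWord-antitone (p ◅ ps) = ≼-trans (edgeWord-antitone ps) (edgeWord-⋖ p)

sourceIndex targetIndex : ∀ {t w} → t ⋖ w → ℕ
sourceIndex (rot A B C) = size A
sourceIndex (left _ p)  = sourceIndex p
sourceIndex (right l p) = suc (size l + sourceIndex p)
targetIndex (rot A B C) = size A + size B
targetIndex (left _ p)  = targetIndex p
targetIndex (right l p) = suc (size l + targetIndex p)

edgeWord-sourceIndex : ∀ {t w} (p : t ⋖ w) → edgeWord t ‼ sourceIndex p ≡ just true
edgeWord-sourceIndex (rot A B C) =
  subst (λ i → (P ++ true ∷ edgeWord (node B C)) ‼ i ≡ just true)
    (length-edgeWord-edgeTo A) (‼-length P)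
  where P = edgeWord A ++ edgeTo false A
edgeWord-sourceIndex (left {l} r p) = ‼-edgeWord-left l r (edgeWord-sourceIndex p)
edgeWord-sourceIndex (right l {r = node B C} p) =
  trans (‼-edgeWord-right l B C (sourceIndex p)) (edgeWord-sourceIndex p)

edgeWord-targetIndex : ∀ {t w} (p : t ⋖ w) → edgeWord w ‼ targetIndex p ≡ just false
edgeWord-targetIndex (rot A B C) =
  ‼-++ˡ (edgeWord (node A B) ++ false ∷ []) (subst (λ i → (edgeWord (node A B) ++ false ∷ []) ‼ i ≡ just false)
    (length-edgeWord (node A B)) (‼-length (edgeWord (node A B))))
edgeWord-targetIndex (left {l' = l′} r p) = ‼-edgeWord-left l′ r (edgeWord-targetIndex p)
edgeWord-targetIndex (right l {r' = node B C} p) =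
  trans (‼-edgeWord-right l B C (targetIndex p)) (edgeWord-targetIndex p)

size-⋖ : ∀ {t w} → t ⋖ w → size t ≡ size w
size-⋖ (rot A B C) =
  cong suc (trans (+-suc (size A) _) (cong suc (sym (+-assoc (size A) (size B) (size C)))))
size-⋖ (left r p)  = cong (λ k → suc (k + size r)) (size-⋖ p)
size-⋖ (right l p) = cong (λ k → suc (size l + k)) (size-⋖ p)

module _ {t w} (p : t ⋖ w) where

  sourceIndex<source : suc (sourceIndex p) < size t
  sourceIndex<source = edgeWord-‼⇒< t (edgeWord-sourceIndex p)

  sourceIndex<target : suc (sourceIndex p) < size w
  sourceIndex<target = subst (suc (sourceIndex p) <_) (size-⋖ p) sourceIndex<source

  targetIndex<target : suc (targetIndex p) < size w
  targetIndex<target = edgeWord-‼⇒< w (edgeWord-targetIndex p)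

  targetIndex<source : suc (targetIndex p) < size t
  targetIndex<source = subst (suc (targetIndex p) <_) (sym (size-⋖ p)) targetIndex<target

m<n⇒m≢1+n+o : ∀ {m n} o → m < n → m ≢ suc (n + o)
m<n⇒m≢1+n+o {n = n} o m<n = <⇒≢ (m<n⇒m<1+n (<-≤-trans m<n (m≤m+n n o)))

1+m<n⇒m≢n : ∀ {m n} → suc m < n → m ≢ n
1+m<n⇒m≢n 1+m<n = <⇒≢ (<⇒≤ 1+m<n)

sourceIndex-injectiveʳ : ∀ {t w₁ w₂} (p : t ⋖ w₁) (q : t ⋖ w₂) →
                         sourceIndex p ≡ sourceIndex q → w₁ ≡ w₂
sourceIndex-injectiveʳ (rot A B C) (rot _ _ _) _ = refl
sourceIndex-injectiveʳ (rot A B C) (left _ q)  e = ⊥-elim (1+m<n⇒m≢n (sourceIndex<source q) (sym e))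
sourceIndex-injectiveʳ (rot A B C) (right _ q) e = ⊥-elim (m≢1+m+n (size A) e)
sourceIndex-injectiveʳ (left r p)  (rot A B C) e = ⊥-elim (1+m<n⇒m≢n (sourceIndex<source p) e)
sourceIndex-injectiveʳ (left r p)  (left _ q)  e = cong (λ l → node l r) (sourceIndex-injectiveʳ p q e)
sourceIndex-injectiveʳ (left r p)  (right _ q) e = ⊥-elim (m<n⇒m≢1+n+o _ (<⇒≤ (sourceIndex<source p)) e)
sourceIndex-injectiveʳ (right l p) (rot A B C) e = ⊥-elim (m≢1+m+n (size A) (sym e))
sourceIndex-injectiveʳ (right l p) (left _ q)  e = ⊥-elim (m<n⇒m≢1+n+o _ (<⇒≤ (sourceIndex<source q)) (sym e))
sourceIndex-injectiveʳ (right l p) (right _ q) e =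
  cong (node l) (sourceIndex-injectiveʳ p q (+-cancelˡ-≡ (size l) _ _ (suc-injective e)))

1+targetIndex≢size-left : ∀ {B C w} (q : node B C ⋖ w) → size B ≢ suc (targetIndex q)
1+targetIndex≢size-left (rot B B′ C′) e = m≢1+m+n (size B) e
1+targetIndex≢size-left (left _ q)    e = <⇒≢ (targetIndex<source q) (sym e)
1+targetIndex≢size-left (right B q)   e =
  m≢1+m+n (size B) (trans e (cong suc (sym (+-suc (size B) (targetIndex q)))))

targetIndex-rot≢left : ∀ {A A′} B (q : A ⋖ A′) → targetIndex q ≢ size A + size B
targetIndex-rot≢left {A} B q = <⇒≢ (<-≤-trans (<⇒≤ (targetIndex<source q)) (m≤m+n (size A) (size B)))

targetIndex-rot≢right : ∀ A {B C r′} (q : node B C ⋖ r′) → size A + size B ≢ suc (size A + targetIndex q)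
targetIndex-rot≢right A q e =
  1+targetIndex≢size-left q (+-cancelˡ-≡ (size A) _ _ (trans e (sym (+-suc (size A) _))))

targetIndex-injectiveʳ : ∀ {t w₁ w₂} (p : t ⋖ w₁) (q : t ⋖ w₂) →
                         targetIndex p ≡ targetIndex q → w₁ ≡ w₂
targetIndex-injectiveʳ (rot A B C) (rot _ _ _) _ = refl
targetIndex-injectiveʳ (rot A B C) (left _ q)  e = ⊥-elim (targetIndex-rot≢left B q (sym e))
targetIndex-injectiveʳ (rot A B C) (right _ q) e = ⊥-elim (targetIndex-rot≢right A q e)
targetIndex-injectiveʳ (left r p)  (rot A B C) e = ⊥-elim (targetIndex-rot≢left B p e)
targetIndex-injectiveʳ (left r p)  (left _ q)  e = cong (λ l → node l r) (targetIndex-injectiveʳ p q e)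
targetIndex-injectiveʳ (left r p)  (right _ q) e = ⊥-elim (m<n⇒m≢1+n+o _ (<⇒≤ (targetIndex<source p)) e)
targetIndex-injectiveʳ (right l p) (rot A B C) e = ⊥-elim (targetIndex-rot≢right A p (sym e))
targetIndex-injectiveʳ (right l p) (left _ q)  e = ⊥-elim (m<n⇒m≢1+n+o _ (<⇒≤ (targetIndex<source q)) (sym e))
targetIndex-injectiveʳ (right l p) (right _ q) e =
  cong (node l) (targetIndex-injectiveʳ p q (+-cancelˡ-≡ (size l) _ _ (suc-injective e)))

sourceIndex≢size-left : ∀ {t A B} (q : t ⋖ node A B) → sourceIndex q ≢ size A
sourceIndex≢size-left (rot A′ B′ C′) e = m≢1+m+n (size A′) e
sourceIndex≢size-left (left _ q)     e = 1+m<n⇒m≢n (sourceIndex<target q) e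
sourceIndex≢size-left (right l q)    e = m≢1+m+n (size l) (sym e)

sourceIndex-injectiveˡ : ∀ {t₁ t₂ w} (p : t₁ ⋖ w) (q : t₂ ⋖ w) →
                         sourceIndex p ≡ sourceIndex q → t₁ ≡ t₂
sourceIndex-injectiveˡ (rot A B C) (rot _ _ _) _ = refl
sourceIndex-injectiveˡ (rot A B C) (left _ q)  e = ⊥-elim (sourceIndex≢size-left q (sym e))
sourceIndex-injectiveˡ (rot A B C) (right _ q) e = ⊥-elim (m<n⇒m≢1+n+o _ (s≤s (m≤m+n (size A) (size B))) e)
sourceIndex-injectiveˡ (left r p)  (rot A B C) e = ⊥-elim (sourceIndex≢size-left p e)
sourceIndex-injectiveˡ (left r p)  (left _ q)  e = cong (λ l → node l r) (sourceIndex-injectiveˡ p q e)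
sourceIndex-injectiveˡ (left r p)  (right _ q) e = ⊥-elim (m<n⇒m≢1+n+o _ (<⇒≤ (sourceIndex<target p)) e)
sourceIndex-injectiveˡ (right l p) (rot A B C) e = ⊥-elim (m<n⇒m≢1+n+o _ (s≤s (m≤m+n (size A) (size B))) (sym e))
sourceIndex-injectiveˡ (right l p) (left _ q)  e = ⊥-elim (m<n⇒m≢1+n+o _ (<⇒≤ (sourceIndex<target q)) (sym e))
sourceIndex-injectiveˡ (right l p) (right _ q) e =
  cong (node l) (sourceIndex-injectiveˡ p q (+-cancelˡ-≡ (size l) _ _ (suc-injective e)))

targetIndex-injectiveˡ : ∀ {t₁ t₂ w} (p : t₁ ⋖ w) (q : t₂ ⋖ w) →
                         targetIndex p ≡ targetIndex q → t₁ ≡ t₂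
targetIndex-injectiveˡ (rot A B C) (rot _ _ _) _ = refl
targetIndex-injectiveˡ (rot A B C) (left _ q)  e = ⊥-elim (<⇒≢ (s<s⁻¹ (targetIndex<target q)) (sym e))
targetIndex-injectiveˡ (rot A B C) (right _ q) e = ⊥-elim (m<n⇒m≢1+n+o _ (n<1+n _) e)
targetIndex-injectiveˡ (left r p)  (rot A B C) e = ⊥-elim (<⇒≢ (s<s⁻¹ (targetIndex<target p)) e)
targetIndex-injectiveˡ (left r p)  (left _ q)  e = cong (λ l → node l r) (targetIndex-injectiveˡ p q e)
targetIndex-injectiveˡ (left r p)  (right _ q) e = ⊥-elim (m<n⇒m≢1+n+o _ (<⇒≤ (targetIndex<target p)) e)
targetIndex-injectiveˡ (right l p) (rot A B C) e = ⊥-elim (m<n⇒m≢1+n+o _ (n<1+n _) (sym e))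
targetIndex-injectiveˡ (right l p) (left _ q)  e = ⊥-elim (m<n⇒m≢1+n+o _ (<⇒≤ (targetIndex<target q)) (sym e))
targetIndex-injectiveˡ (right l p) (right _ q) e =
  cong (node l) (targetIndex-injectiveˡ p q (+-cancelˡ-≡ (size l) _ _ (suc-injective e)))

module _ {s t : Tree} {L : List Tree} (!L : Unique L) where

  upperCovers≤rightEdges : s ≤T t → (∀ {w} → w ∈ L → t ⋖ w) → length L ≤ rightEdges s
  upperCovers≤rightEdges s≤t cover = pigeonhole (λ w i → ∃[ p ] sourceIndex {t} {w} p ≡ i)
    (λ (p , e₁) (q , e₂) → sourceIndex-injectiveʳ p q (trans e₁ (sym e₂))) !L
    λ w∈L → let p = cover w∈L in
      sourceIndex p , ‼⇒∈indices (edgeWord s)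
        (≼-‼-true (edgeWord-antitone s≤t) (edgeWord-sourceIndex p)) , p , refl

  upperCovers≤leftEdges : (∀ {w} → w ∈ L → t ⋖ w × w ≤T s) → length L ≤ leftEdges s
  upperCovers≤leftEdges cover = pigeonhole (λ w i → ∃[ p ] targetIndex {t} {w} p ≡ i)
    (λ (p , e₁) (q , e₂) → targetIndex-injectiveʳ p q (trans e₁ (sym e₂))) !L
    λ w∈L → let (p , w≤s) = cover w∈L in
      targetIndex p , ‼⇒∈indices (edgeWord s)
        (≼-‼-false (edgeWord-antitone w≤s) (edgeWord-targetIndex p)) , p , refl

  lowerCovers≤leftEdges : t ≤T s → (∀ {w} → w ∈ L → w ⋖ t) → length L ≤ leftEdges s
  lowerCovers≤leftEdges t≤s cover = pigeonhole (λ w i → ∃[ p ] targetIndex {w} {t} p ≡ i)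
    (λ (p , e₁) (q , e₂) → targetIndex-injectiveˡ p q (trans e₁ (sym e₂))) !L
    λ w∈L → let p = cover w∈L in
      targetIndex p , ‼⇒∈indices (edgeWord s)
        (≼-‼-false (edgeWord-antitone t≤s) (edgeWord-targetIndex p)) , p , refl

  lowerCovers≤rightEdges : (∀ {w} → w ∈ L → w ⋖ t × s ≤T w) → length L ≤ rightEdges s
  lowerCovers≤rightEdges cover = pigeonhole (λ w i → ∃[ p ] sourceIndex {w} {t} p ≡ i)
    (λ (p , e₁) (q , e₂) → sourceIndex-injectiveˡ p q (trans e₁ (sym e₂))) !L
    λ w∈L → let (p , s≤w) = cover w∈L in
      sourceIndex p , ‼⇒∈indices (edgeWord s)
        (≼-‼-true (edgeWord-antitone s≤w) (edgeWord-sourceIndex p)) , p , refl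

members : ∀ {P L t} → Enumerates P L → t ∈ L → P t
members (_ , L⇔P) t∈L = Equivalence.to (L⇔P _) t∈L

lemma3 : (n : ℕ) → 1 ≤ n → (u v : Tree) → size u ≡ n → size v ≡ n → u ≤T v →
    (La Lb Lc Ld : List Tree) →
    Enumerates (λ u' → (u ⋖ u') × (u' ≤T v)) La →
    Enumerates (λ v' → v ⋖ v') Lb →
    Enumerates (λ u' → u' ⋖ u) Lc →
    Enumerates (λ v' → (u ≤T v') × (v' ⋖ v)) Ld →
    DegreeBounds (n ∸ 1) (length La) (length Lb) (length Lc) (length Ld)
lemma3 _ _ u v refl size-v u≤v La Lb Lc Ld EA EB EC ED =
  a+c , b+d , a+b , d+c , b+c ,
  m+n≤o⇒m≤o _ a+c , m+n≤o⇒m≤o _ b+d , m+n≤o⇒n≤o _ a+c , m+n≤o⇒n≤o _ b+d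
  where
  edges-u : rightEdges u + leftEdges u ≡ size u ∸ 1
  edges-u = rightEdges+leftEdges u
  edges-v : rightEdges v + leftEdges v ≡ size u ∸ 1
  edges-v = trans (rightEdges+leftEdges v) (cong (_∸ 1) size-v)

  a≤Ru : length La ≤ rightEdges u
  a≤Ru = upperCovers≤rightEdges (proj₁ EA) ε (λ w∈ → proj₁ (members EA w∈))
  a≤Lv : length La ≤ leftEdges v
  a≤Lv = upperCovers≤leftEdges (proj₁ EA) (members EA)
  b≤Rv : length Lb ≤ rightEdges v
  b≤Rv = upperCovers≤rightEdges (proj₁ EB) ε (members EB)
  b≤Ru : length Lb ≤ rightEdges u
  b≤Ru = upperCovers≤rightEdges (proj₁ EB) u≤v (members EB)
  c≤Lu : length Lc ≤ leftEdges u
  c≤Lu = lowerCovers≤leftEdges (proj₁ EC) ε (members EC)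
  d≤Lv : length Ld ≤ leftEdges v
  d≤Lv = lowerCovers≤leftEdges (proj₁ ED) ε (λ w∈ → proj₂ (members ED w∈))
  d≤Ru : length Ld ≤ rightEdges u
  d≤Ru = lowerCovers≤rightEdges (proj₁ ED) (λ w∈ → swap (members ED w∈))

  add-bounds : ∀ {a b x y} → a ≤ x → b ≤ y → x + y ≡ size u ∸ 1 → a + b ≤ size u ∸ 1
  add-bounds a≤x b≤y x+y≡ = ≤-trans (+-mono-≤ a≤x b≤y) (≤-reflexive x+y≡)

  a+c : length La + length Lc ≤ size u ∸ 1
  a+c = add-bounds a≤Ru c≤Lu edges-u
  b+d : length Lb + length Ld ≤ size u ∸ 1
  b+d = add-bounds b≤Rv d≤Lv edges-v
  a+b : length La + length Lb ≤ size u ∸ 1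
  a+b = add-bounds a≤Lv b≤Rv (trans (+-comm (leftEdges v) _) edges-v)
  d+c : length Ld + length Lc ≤ size u ∸ 1
  d+c = add-bounds d≤Ru c≤Lu edges-u
  b+c : length Lb + length Lc ≤ size u ∸ 1
  b+c = add-bounds b≤Ru c≤Lu edges-u
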